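{- Let $\mathcal M=(M_n)_{n\ge1}$ be a $\mathrm{Sym}$-invariant chain of monoids $M_n\subseteq\mathbb Z^n_{\ge0}$ with limit $M_\infty=\bigcup_nM_n$. Then the following are equivalent: (a) $\mathcal M$ stabilizes and $M_n$ is a finitely generated monoid for all sufficiently large $n$; (b) there exists $r\in\mathbb N$ such that for all $n\ge r$: (i) $M_\infty\cap\mathbb Z^n_{\ge0}=M_n$, and (ii) $M_n$ is finitely generated (as a monoid) by elements of support size at most $r$; (c) $M_\infty$ is $\mathrm{Sym}$-equivariantly finitely generated, i.e. $M_\infty=\mathrm{Mon}(\mathrm{Sym}(\infty)(G))$ for some finite $G\subseteq M_\infty$.
   Context: Identify $\mathbb Z^m$ with a subset of $\mathbb Z^n$ ($m\le n$) via $v\mapsto(v,0,\dots,0)$, and let $\mathbb Z^{(\mathbb N)}_{\ge0}=\bigcup_n\mathbb Z^n_{\ge0}$. $\mathrm{Mon}(A)=\{\sum_{i=1}^km_ia_i: k\in\mathbb N, a_i\in A, m_i\in\mathbb Z_{\ge0}\}$; a monoid here is a set $M$ with $\mathrm{Mon}(M)=M$. For $m\le n$, $\mathrm{Sym}_{m,n}$ is the set of injective maps $\pi:[m]\to[n]$, acting by $\pi(\sum_kv_k\epsilon_k)=\sum_kv_k\epsilon_{\pi(k)}$; $\mathrm{Sym}(\infty)$ (permutations of $\mathbb N$ fixing all but finitely many points) acts on $\mathbb Z^{(\mathbb N)}$ likewise. Support size is the number of nonzero coordinates. A chain of monoids has $M_n\subseteq M_{n+1}$; it is $\mathrm{Sym}$-invariant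 if $\mathrm{Mon}(\mathrm{Sym}_{m,n}(M_m))\subseteq M_n$ for all $n\ge m$, and stabilizes if there is $r$ with $\mathrm{Mon}(\mathrm{Sym}_{m,n}(M_m))=M_n$ for all $n\ge m\ge r$. -}

module Defs where

open import Level using (0ℓ)
open import Data.Nat using (ℕ; zero; suc; _+_; _*_; _≤_)
open import Data.Fin using (Fin; _≟_)
open import Data.Vec using (Vec; []; _∷_; lookup; tabulate; zipWith; replicate)
import Data.Vec as V
open import Data.List using (List; map; foldr; allFin; length; filter)
open import Data.List.Relation.Unary.All using (All)
open import Data.List.Relation.Unary.Any using (Any)
open import Data.Product using (Σ; ∃; ∃-syntax; _×_; _,_; proj₁; proj₂)
open import Relation.Binary.PropositionalEquality using (_≡_; _≢_)
open import Relation.Nullary using (does)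
open import Data.Bool using (if_then_else_)
open import Relation.Unary using (Pred; _⊆_; _≐_; _∩_)
open import Function.Definitions using (Injective; Bijective)

-- ℤ^n_{≥0} is represented by Vec ℕ n.

_+v_ : ∀ {n} → Vec ℕ n → Vec ℕ n → Vec ℕ n
_+v_ = zipWith _+_

_·v_ : ∀ {n} → ℕ → Vec ℕ n → Vec ℕ n
c ·v v = V.map (c *_) v

0v : ∀ {n} → Vec ℕ n
0v = replicate _ 0

vsum : ∀ {n} → List (Vec ℕ n) → Vec ℕ n
vsum = foldr _+v_ 0v

unit : ∀ {n} → Fin n → Vec ℕ n
unit j = tabulate λ i → if does (i ≟ j) then 1 else 0

Mon : ∀ {n} → Pred (Vec ℕ n) 0ℓ → Pred (Vec ℕ n) 0ℓ
Mon {n} A v = ∃[ L ] (All (λ p → A (proj₂ p)) L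
                    × v ≡ vsum (map (λ (p : ℕ × Vec ℕ n) → proj₁ p ·v proj₂ p) L))

IsMonoid : ∀ {n} → Pred (Vec ℕ n) 0ℓ → Set
IsMonoid M = Mon M ≐ M

FinGen : ∀ {n} → Pred (Vec ℕ n) 0ℓ → Set
FinGen {n} M = ∃[ G ] (All M G × Mon (λ v → Any (v ≡_) G) ≐ M)

-- Sym_{m,n}: injective maps [m] → [n], acting by π(Σ v_k ε_k) = Σ v_k ε_{π(k)}
act : ∀ {m n} → (Fin m → Fin n) → Vec ℕ m → Vec ℕ n
act {m} π v = vsum (map (λ k → lookup v k ·v unit (π k)) (allFin m))

SymImg : ∀ m n → Pred (Vec ℕ m) 0ℓ → Pred (Vec ℕ n) 0ℓ
SymImg m n A w = ∃[ π ] (Injective _≡_ _≡_ π × ∃[ v ] (A v × w ≡ act π v))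

supp : ∀ {n} → Vec ℕ n → ℕ
supp []           = 0
supp (zero ∷ v)   = supp v
supp (suc _ ∷ v)  = suc (supp v)

-- ℤ^(ℕ)_{≥0}: an element of ℤ^n is viewed as the sequence (v,0,0,...).

at : ∀ {n} → Vec ℕ n → ℕ → ℕ
at []      _       = 0
at (x ∷ v) zero    = x
at (x ∷ v) (suc i) = at v i

-- same element of ℤ^(ℕ) (this realises the identification ℤ^m ⊆ ℤ^n)
_≈_ : ∀ {m n} → Vec ℕ m → Vec ℕ n → Set
v ≈ w = ∀ i → at v i ≡ at w i

-- a chain of subsets M_n ⊆ ℤ^n_{≥0}  (only n ≥ 1 is used)
Chain : Set₁
Chain = (n : ℕ) → Pred (Vec ℕ n) 0ℓ

IsChainOfMonoids : Chain → Set
IsChainOfMonoids M =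
  (∀ n → 1 ≤ n → IsMonoid (M n)) ×
  (∀ n → 1 ≤ n → ∀ (v : Vec ℕ n) (w : Vec ℕ (suc n)) → M n v → v ≈ w → M (suc n) w)

SymInvariant : Chain → Set
SymInvariant M = ∀ m n → 1 ≤ m → m ≤ n → Mon (SymImg m n (M m)) ⊆ M n

Stabilizes : Chain → Set
Stabilizes M = ∃[ r ] (∀ m n → 1 ≤ m → r ≤ m → m ≤ n → Mon (SymImg m n (M m)) ≐ M n)

Limit : Chain → Pred (ℕ → ℕ) 0ℓ
Limit M f = ∃[ n ] (1 ≤ n × ∃[ v ] (M n v × ∀ i → at v i ≡ f i))

MonSeq : Pred (ℕ → ℕ) 0ℓ → Pred (ℕ → ℕ) 0ℓ
MonSeq S f = ∃[ L ] (All (λ (p : ℕ × (ℕ → ℕ)) → S (proj₂ p)) L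
                   × ∀ i → f i ≡ foldr _+_ 0 (map (λ (p : ℕ × (ℕ → ℕ)) → proj₁ p * proj₂ p i) L))

IsFinPerm : (ℕ → ℕ) → Set
IsFinPerm σ = Bijective _≡_ _≡_ σ × ∃[ B ] (∀ i → B ≤ i → σ i ≡ i)

-- Sym(∞)(G): σ(Σ g_k ε_k) = Σ g_k ε_{σ(k)}, i.e. (σ g)(σ k) = g k
SymInfImg : List (ℕ → ℕ) → Pred (ℕ → ℕ) 0ℓ
SymInfImg G f = ∃[ σ ] (IsFinPerm σ × Any (λ g → ∀ k → f (σ k) ≡ g k) G)

-- A summand (with nonzero coefficient) of an ℕ-combination is bounded by the sum, so it is
-- supported wherever the sum is. Hence an element of Sym_{n,k}(M_n) occurring in an element
-- of ℤ^n is a relabelling of an element of M_n inside ℤ^n, and lies in M_n. Beyond the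
-- stabilisation index this gives M_∞ ∩ ℤ^n = M_n, and the finite orbit Sym_{r,n}(G) of a
-- generating set G of M_r generates M_n: (a) ⇒ (b). Conversely, a generator of M_n of support
-- at most r ≤ m is the Sym_{m,n}-image of some u ∈ M_∞ ∩ ℤ^m = M_m, which is (b) ⇒ (a); the
-- injection involved extends to a finite permutation of ℕ, so the generators of M_n are
-- Sym(∞)-images of combinations of generators of M_r, which is (b) ⇒ (c). For (c) ⇒ (b), if
-- the generators of M_∞ come from M_k with k ≤ r, a Sym(∞)-image of one of them supported in
-- the first n coordinates is a Sym_{k,n}-image, so these finite orbits generate M_n.
-- Relabellings between finitely supported sequences are realised by permutations of Fin n
-- built from transpositions.

module Submission where

open import Defs
open import Level using (0ℓ)
open import Data.Nat using (ℕ; zero; suc; _+_; _*_; _≤_; _<_; s≤s; _≤?_; _<?_; _⊔_; _≟_)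
open import Data.Nat.Properties
open import Data.Fin as Fin using (Fin; toℕ; fromℕ<; inject≤) renaming (zero to fzero; suc to fsuc)
import Data.Fin.Properties as Finₚ
open import Data.Fin.Permutation as Perm
  using (Permutation′; _⟨$⟩ʳ_; _⟨$⟩ˡ_; inverseˡ; inverseʳ; transpose; _∘ₚ_)
open import Data.Vec using (Vec; []; _∷_; lookup; tabulate)
import Data.Vec.Properties as Vecₚ
open import Data.List as List using (List; []; _∷_; map; allFin; _++_)
import Data.List.Properties as Listₚ
open import Data.Nat.ListAction using (sum)
import Data.Nat.ListAction.Properties as ListActionₚ
open import Data.List.Relation.Unary.All as All using (All; []; _∷_)
import Data.List.Relation.Unary.All.Properties as Allₚ
open import Data.List.Relation.Unary.Any as Any using (Any; here; there)
import Data.List.Relation.Unary.Any.Properties as Anyₚ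
open import Data.List.Membership.Propositional using (_∈_; find)
open import Data.List.Membership.Propositional.Properties
  using (∈-cartesianProductWith⁺; ∈-cartesianProductWith⁻; ∈-filter⁺; ∈-filter⁻; ∈-allFin; ∈-++⁺ˡ; ∈-++⁺ʳ)
open import Data.Product as Product using (∃₂; ∃-syntax; _×_; _,_; proj₁; proj₂)
open import Data.Sum using (inj₁; inj₂)
open import Data.Empty using (⊥-elim)
open import Function using (_∘_; id)
open import Function.Bundles using (_⇔_; mk⇔)
open import Function.Definitions using (Injective; Surjective; Bijective)
open import Relation.Binary.PropositionalEquality
open import Relation.Nullary using (yes; no; Dec; does)
open import Relation.Nullary.Decidable using (dec-true; dec-false; map′; _→-dec_)
open import Data.Bool using (if_then_else_)
open import Relation.Unary using (Pred; _⊆_; _≐_)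

-- Vectors as finitely supported sequences

VanishesFrom : ℕ → (ℕ → ℕ) → Set
VanishesFrom n f = ∀ j → n ≤ j → f j ≡ 0

at-vanishes : ∀ {k n} (v : Vec ℕ k) → k ≤ n → VanishesFrom n (at v)
at-vanishes []      _         _       _         = refl
at-vanishes (x ∷ v) (s≤s k≤n) (suc j) (s≤s n≤j) = at-vanishes v k≤n j n≤j

≤-vanishes : ∀ {n} {f g : ℕ → ℕ} → (∀ j → f j ≤ g j) → VanishesFrom n g → VanishesFrom n f
≤-vanishes f≤g g≥n j n≤j = n≤0⇒n≡0 (subst (_ ≤_) (g≥n j n≤j) (f≤g j))

at-toℕ : ∀ {n} (v : Vec ℕ n) i → at v (toℕ i) ≡ lookup v i
at-toℕ (x ∷ v) fzero    = refl
at-toℕ (x ∷ v) (fsuc i) = at-toℕ v i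

at-injective : ∀ {n} {v w : Vec ℕ n} → at v ≗ at w → v ≡ w
at-injective {v = []}    {[]}    _ = refl
at-injective {v = x ∷ v} {y ∷ w} e = cong₂ _∷_ (e 0) (at-injective (e ∘ suc))

lookup-injective : ∀ {n} {v w : Vec ℕ n} → (∀ i → lookup v i ≡ lookup w i) → v ≡ w
lookup-injective {v = v} {w} e =
  trans (sym (Vecₚ.tabulate∘lookup v)) (trans (Vecₚ.tabulate-cong e) (Vecₚ.tabulate∘lookup w))

toVec : ∀ n → (ℕ → ℕ) → Vec ℕ n
toVec n f = tabulate (f ∘ toℕ)

at-toVec : ∀ n {f} → VanishesFrom n f → at (toVec n f) ≗ f
at-toVec n {f} f≥n j with j <? n
... | yes j<n = begin
  at (toVec n f) j                     ≡⟨ cong (at (toVec n f)) (sym (Finₚ.toℕ-fromℕ< j<n)) ⟩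
  at (toVec n f) (toℕ (fromℕ< j<n))    ≡⟨ at-toℕ (toVec n f) _ ⟩
  lookup (toVec n f) (fromℕ< j<n)      ≡⟨ Vecₚ.lookup∘tabulate (f ∘ toℕ) _ ⟩
  f (toℕ (fromℕ< j<n))                 ≡⟨ cong f (Finₚ.toℕ-fromℕ< j<n) ⟩
  f j                                  ∎
  where open ≡-Reasoning
... | no j≮n = trans (at-vanishes (toVec n f) ≤-refl j (≮⇒≥ j≮n)) (sym (f≥n j (≮⇒≥ j≮n)))

at-nonzero⇒index : ∀ {m} (v : Vec ℕ m) {i} → at v i ≢ 0 → ∃[ a ] toℕ a ≡ i
at-nonzero⇒index {m} v {i} vᵢ≢0 with i <? m
... | yes i<m = fromℕ< i<m , Finₚ.toℕ-fromℕ< i<m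
... | no  i≮m = ⊥-elim (vᵢ≢0 (at-vanishes v ≤-refl i (≮⇒≥ i≮m)))

at-+v : ∀ {n} (v w : Vec ℕ n) j → at (v +v w) j ≡ at v j + at w j
at-+v []      []      j       = refl
at-+v (x ∷ v) (y ∷ w) zero    = refl
at-+v (x ∷ v) (y ∷ w) (suc j) = at-+v v w j

at-·v : ∀ {n} c (v : Vec ℕ n) j → at (c ·v v) j ≡ c * at v j
at-·v c []      j       = sym (*-zeroʳ c)
at-·v c (x ∷ v) zero    = refl
at-·v c (x ∷ v) (suc j) = at-·v c v j

at-0v : ∀ {n} j → at (0v {n}) j ≡ 0
at-0v {zero}  j       = refl
at-0v {suc n} zero    = refl
at-0v {suc n} (suc j) = at-0v {n} j

at-vsum : ∀ {n} (vs : List (Vec ℕ n)) j → at (vsum vs) j ≡ sum (map (λ v → at v j) vs)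
at-vsum {n} []       j = at-0v {n} j
at-vsum     (v ∷ vs) j = trans (at-+v v (vsum vs) j) (cong (at v j +_) (at-vsum vs j))

-- ℕ-linear combinations, read coordinatewise

private variable
  X Y : Set
  h : X → ℕ → ℕ
  Q : Pred X 0ℓ

lincomb : (X → ℕ → ℕ) → List (ℕ × X) → ℕ → ℕ
lincomb h L j = sum (map (λ p → proj₁ p * h (proj₂ p) j) L)

-- Mon(Q), with the elements of Q read as sequences through h
Comb : (X → ℕ → ℕ) → Pred X 0ℓ → Pred (ℕ → ℕ) 0ℓ
Comb h Q f = ∃[ L ] (All (Q ∘ proj₂) L × f ≗ lincomb h L)

lincomb-++ : ∀ (L K : List (ℕ × X)) j → lincomb h (L ++ K) j ≡ lincomb h L j + lincomb h K j
lincomb-++ {h = h} L K j =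
  trans (cong sum (Listₚ.map-++ _ L K)) (ListActionₚ.sum-++ (map (λ p → proj₁ p * h (proj₂ p) j) L) _)

lincomb-scale : ∀ c (L : List (ℕ × X)) j →
  lincomb h (map (λ p → c * proj₁ p , proj₂ p) L) j ≡ c * lincomb h L j
lincomb-scale     c []            j = sym (*-zeroʳ c)
lincomb-scale {h = h} c ((d , x) ∷ L) j = begin
  c * d * h x j + lincomb h (map _ L) j ≡⟨ cong₂ _+_ (*-assoc c d (h x j)) (lincomb-scale {h = h} c L j) ⟩
  c * (d * h x j) + c * lincomb h L j   ≡⟨ *-distribˡ-+ c _ _ ⟨
  c * (d * h x j + lincomb h L j)       ∎
  where open ≡-Reasoning

lincomb-cong : ∀ {k : X → ℕ → ℕ} {i j} (L : List (ℕ × X)) → (∀ x → h x i ≡ k x j) →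
  lincomb h L i ≡ lincomb k L j
lincomb-cong []            hi≡kj = refl
lincomb-cong {h = h} {k} ((c , x) ∷ L) hi≡kj =
  cong₂ _+_ (cong (c *_) (hi≡kj x)) (lincomb-cong {h = h} {k} L hi≡kj)

lincomb-zero : ∀ {j} (L : List (ℕ × X)) → (∀ x → h x j ≡ 0) → lincomb h L j ≡ 0
lincomb-zero []            hj≡0 = refl
lincomb-zero {h = h} ((c , x) ∷ L) hj≡0 =
  cong₂ _+_ (trans (cong (c *_) (hj≡0 x)) (*-zeroʳ c)) (lincomb-zero {h = h} L hj≡0)

Comb-resp : ∀ {f g} → f ≗ g → Comb h Q f → Comb h Q g
Comb-resp f≗g (L , qs , f≗L) = L , qs , λ j → trans (sym (f≗g j)) (f≗L j)

Comb-singleton : ∀ {x} → Q x → Comb h Q (h x)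
Comb-singleton {x = x} q = (1 , x) ∷ [] , q ∷ [] , λ j → sym (trans (+-identityʳ _) (*-identityˡ _))

Comb-+ : ∀ {f g} → Comb h Q f → Comb h Q g → Comb h Q (λ j → f j + g j)
Comb-+ {h = h} (L , qs , f≗L) (K , rs , g≗K) =
  L ++ K , Allₚ.++⁺ qs rs , λ j → trans (cong₂ _+_ (f≗L j) (g≗K j)) (sym (lincomb-++ {h = h} L K j))

Comb-scale : ∀ c {f} → Comb h Q f → Comb h Q (λ j → c * f j)
Comb-scale {h = h} c (L , qs , f≗L) =
  map (λ p → c * proj₁ p , proj₂ p) L , Allₚ.map⁺ qs ,
  λ j → trans (cong (c *_) (f≗L j)) (sym (lincomb-scale {h = h} c L j))

-- Zero coefficients are dropped, so every summand passed to expand is bounded by the sum.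
Comb-bind : ∀ {k : Y → ℕ → ℕ} {R : Pred Y 0ℓ} {f} →
  (∀ {x} → Q x → (∀ j → h x j ≤ f j) → Comb k R (h x)) → Comb h Q f → Comb k R f
Comb-bind {Q = Q} {h = h} {k = k} {R = R} {f = f} expand (L , qs , f≗L) =
  Comb-resp (sym ∘ f≗L) (go L qs (λ j → ≤-reflexive (sym (f≗L j))))
  where
  go : (K : List (ℕ × _)) → All (Q ∘ proj₂) K → (∀ j → lincomb h K j ≤ f j) → Comb k R (lincomb h K)
  go []                 []       _    = [] , [] , λ _ → refl
  go ((zero  , x) ∷ K) (_ ∷ qs) K≤f = go K qs K≤f
  go ((suc c , x) ∷ K) (q ∷ qs) K≤f =
    Comb-+ (Comb-scale (suc c) (expand q x≤f)) (go K qs (λ j → ≤-trans (m≤n+m _ _) (K≤f j)))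
    where
    x≤f : ∀ j → h x j ≤ f j
    x≤f j = ≤-trans (≤-trans (m≤m+n (h x j) (c * h x j)) (m≤m+n _ _)) (K≤f j)

Comb-vanishes : ∀ {f} → (∀ {x} → Q x → ∃[ N ] VanishesFrom N (h x)) → Comb h Q f → ∃[ N ] VanishesFrom N f
Comb-vanishes {Q = Q} {h = h} bounded (L , qs , f≗L) =
  Product.map₂ (λ L≥N j N≤j → trans (f≗L j) (L≥N j N≤j)) (go L qs)
  where
  go : ∀ K → All (Q ∘ proj₂) K → ∃[ N ] VanishesFrom N (lincomb h K)
  go []            []       = 0 , λ _ _ → refl
  go ((c , x) ∷ K) (q ∷ qs) with bounded q | go K qs
  ... | N₁ , x≥N₁ | N₂ , K≥N₂ = N₁ ⊔ N₂ , λ j N≤j →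
    cong₂ _+_ (trans (cong (c *_) (x≥N₁ j (≤-trans (m≤m⊔n N₁ N₂) N≤j))) (*-zeroʳ c))
              (K≥N₂ j (≤-trans (m≤n⊔m N₁ N₂) N≤j))

at-lincomb : ∀ {n} (L : List (ℕ × Vec ℕ n)) → at (vsum (map (λ p → proj₁ p ·v proj₂ p) L)) ≗ lincomb at L
at-lincomb {n} []            j = at-0v {n} j
at-lincomb     ((c , v) ∷ L) j =
  trans (at-+v (c ·v v) _ j) (cong₂ _+_ (at-·v c v j) (at-lincomb L j))

Mon⇒Comb : ∀ {n} {B : Pred (Vec ℕ n) 0ℓ} {w} → Mon B w → Comb at B (at w)
Mon⇒Comb (L , bs , refl) = L , bs , at-lincomb L

Comb⇒Mon : ∀ {n} {B : Pred (Vec ℕ n) 0ℓ} {w} → Comb at B (at w) → Mon B w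
Comb⇒Mon (L , bs , w≗L) = L , bs , at-injective (λ j → trans (w≗L j) (sym (at-lincomb L j)))

Mon-mono : ∀ {n} {A B : Pred (Vec ℕ n) 0ℓ} → A ⊆ B → Mon A ⊆ Mon B
Mon-mono A⊆B (L , as , e) = L , All.map A⊆B as , e

-- The action of Sym_{m,n}

sum-tabulate-zero : ∀ {m} (f : Fin m → ℕ) → (∀ k → f k ≡ 0) → sum (List.tabulate f) ≡ 0
sum-tabulate-zero {zero}  f f≡0 = refl
sum-tabulate-zero {suc m} f f≡0 = cong₂ _+_ (f≡0 fzero) (sum-tabulate-zero (f ∘ fsuc) (f≡0 ∘ fsuc))

sum-tabulate-single : ∀ {m} (f : Fin m → ℕ) k₀ → (∀ k → k ≢ k₀ → f k ≡ 0) → sum (List.tabulate f) ≡ f k₀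
sum-tabulate-single f fzero f≡0 =
  trans (cong (f fzero +_) (sum-tabulate-zero (f ∘ fsuc) (λ k → f≡0 (fsuc k) (λ ())))) (+-identityʳ _)
sum-tabulate-single f (fsuc k₀) f≡0 =
  cong₂ _+_ (f≡0 fzero (λ ()))
            (sum-tabulate-single (f ∘ fsuc) k₀ (λ k k≢k₀ → f≡0 (fsuc k) (k≢k₀ ∘ Finₚ.suc-injective)))

at-unit-≡ : ∀ {n} (t : Fin n) → at (unit t) (toℕ t) ≡ 1
at-unit-≡ t = begin
  at (unit t) (toℕ t)                       ≡⟨ at-toℕ (unit t) t ⟩
  lookup (unit t) t                         ≡⟨ Vecₚ.lookup∘tabulate (λ i → if does (i Fin.≟ t) then 1 else 0) t ⟩
  (if does (t Fin.≟ t) then 1 else 0)       ≡⟨ cong (if_then 1 else 0) (dec-true (t Fin.≟ t) refl) ⟩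
  1                                         ∎
  where open ≡-Reasoning

at-unit-≢ : ∀ {n} (t : Fin n) j → toℕ t ≢ j → at (unit t) j ≡ 0
at-unit-≢ {n} t j t≢j with j <? n
... | no j≮n = at-vanishes (unit t) ≤-refl j (≮⇒≥ j≮n)
... | yes j<n = begin
  at (unit t) j                             ≡⟨ cong (at (unit t)) (sym (Finₚ.toℕ-fromℕ< j<n)) ⟩
  at (unit t) (toℕ i)                       ≡⟨ at-toℕ (unit t) i ⟩
  lookup (unit t) i                         ≡⟨ Vecₚ.lookup∘tabulate (λ i → if does (i Fin.≟ t) then 1 else 0) i ⟩
  (if does (i Fin.≟ t) then 1 else 0)       ≡⟨ cong (if_then 1 else 0) (dec-false (i Fin.≟ t) i≢t) ⟩
  0                                         ∎
  where
  open ≡-Reasoning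
  i = fromℕ< j<n
  i≢t : i ≢ t
  i≢t i≡t = t≢j (trans (cong toℕ (sym i≡t)) (Finₚ.toℕ-fromℕ< j<n))

at-act : ∀ {m n} (π : Fin m → Fin n) v j →
  at (act π v) j ≡ sum (List.tabulate (λ k → lookup v k * at (unit (π k)) j))
at-act {m} π v j = begin
  at (act π v) j                                   ≡⟨ at-vsum (map term (allFin m)) j ⟩
  sum (map (λ w → at w j) (map term (allFin m)))   ≡⟨ cong sum (Listₚ.map-∘ (allFin m)) ⟨
  sum (map (λ k → at (term k) j) (allFin m))       ≡⟨ cong sum (Listₚ.map-cong at-term (allFin m)) ⟩
  sum (map coefficient (allFin m))                 ≡⟨ cong sum (Listₚ.map-tabulate id coefficient) ⟩
  sum (List.tabulate coefficient)                  ∎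
  where
  open ≡-Reasoning
  term = λ k → lookup v k ·v unit (π k)
  coefficient = λ k → lookup v k * at (unit (π k)) j
  at-term : ∀ k → at (term k) j ≡ coefficient k
  at-term k = at-·v (lookup v k) (unit (π k)) j

at-act-image : ∀ {m n} {π : Fin m → Fin n} → Injective _≡_ _≡_ π →
  ∀ v k → at (act π v) (toℕ (π k)) ≡ lookup v k
at-act-image {π = π} π-inj v k = begin
  at (act π v) (toℕ (π k))                                      ≡⟨ at-act π v _ ⟩
  sum (List.tabulate (λ k′ → lookup v k′ * at (unit (π k′)) (toℕ (π k)))) ≡⟨ sum-tabulate-single _ k others ⟩
  lookup v k * at (unit (π k)) (toℕ (π k))                      ≡⟨ cong (lookup v k *_) (at-unit-≡ (π k)) ⟩
  lookup v k * 1                                                ≡⟨ *-identityʳ _ ⟩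
  lookup v k                                                    ∎
  where
  open ≡-Reasoning
  others : ∀ k′ → k′ ≢ k → lookup v k′ * at (unit (π k′)) (toℕ (π k)) ≡ 0
  others k′ k′≢k = trans (cong (lookup v k′ *_) (at-unit-≢ (π k′) _ (k′≢k ∘ π-inj ∘ Finₚ.toℕ-injective)))
                         (*-zeroʳ (lookup v k′))

at-act-outside : ∀ {m n} (π : Fin m → Fin n) v j → (∀ k → toℕ (π k) ≢ j) → at (act π v) j ≡ 0
at-act-outside π v j j∉π = trans (at-act π v j)
  (sum-tabulate-zero _ λ k → trans (cong (lookup v k *_) (at-unit-≢ (π k) j (j∉π k))) (*-zeroʳ (lookup v k)))

act-cong : ∀ {m n} {π π′ : Fin m → Fin n} → π ≗ π′ → ∀ v → act π v ≡ act π′ v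
act-cong {m} π≗π′ v = cong vsum (Listₚ.map-cong (λ k → cong (λ t → lookup v k ·v unit t) (π≗π′ k)) (allFin m))

at-act-lincomb : ∀ {m n} {π : Fin m → Fin n} → Injective _≡_ _≡_ π → ∀ {u} (L : List (ℕ × Vec ℕ m)) →
  at u ≗ lincomb at L → at (act π u) ≗ lincomb (at ∘ act π) L
at-act-lincomb {π = π} π-inj {u} L u≗L j with Finₚ.any? (λ k → toℕ (π k) ≟ j)
... | yes (k , refl) = begin
  at (act π u) (toℕ (π k))           ≡⟨ at-act-image π-inj u k ⟩
  lookup u k                         ≡⟨ at-toℕ u k ⟨
  at u (toℕ k)                       ≡⟨ u≗L (toℕ k) ⟩
  lincomb at L (toℕ k)               ≡⟨ lincomb-cong {h = at} {at ∘ act π} L moved ⟩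
  lincomb (at ∘ act π) L (toℕ (π k)) ∎
  where
  open ≡-Reasoning
  moved : ∀ v → at v (toℕ k) ≡ at (act π v) (toℕ (π k))
  moved v = trans (at-toℕ v k) (sym (at-act-image π-inj v k))
... | no j∉π =
  trans (at-act-outside π u j j∉π′) (sym (lincomb-zero {h = at ∘ act π} L (λ v → at-act-outside π v j j∉π′)))
  where
  j∉π′ : ∀ k → toℕ (π k) ≢ j
  j∉π′ k e = j∉π (k , e)

-- Support size

support : ∀ {n} (y : Vec ℕ n) → Fin (supp y) → Fin n
support (zero  ∷ y) s        = fsuc (support y s)
support (suc _ ∷ y) fzero    = fzero
support (suc _ ∷ y) (fsuc s) = fsuc (support y s)

support-injective : ∀ {n} (y : Vec ℕ n) → Injective _≡_ _≡_ (support y)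
support-injective (zero  ∷ y) {s} {s′} e = support-injective y (Finₚ.suc-injective e)
support-injective (suc _ ∷ y) {fzero}  {fzero}   _ = refl
support-injective (suc _ ∷ y) {fsuc s} {fsuc s′} e = cong fsuc (support-injective y (Finₚ.suc-injective e))

support-nonzero : ∀ {n} (y : Vec ℕ n) s → lookup y (support y s) ≢ 0
support-nonzero (zero  ∷ y) s        = support-nonzero y s
support-nonzero (suc _ ∷ y) fzero    ()
support-nonzero (suc _ ∷ y) (fsuc s) = support-nonzero y s

CoversSupport : ∀ {k n} → (Fin k → Fin n) → Vec ℕ n → Set
CoversSupport ι y = ∀ i → lookup y i ≢ 0 → ∃[ t ] ι t ≡ i

support-covers : ∀ {n} (y : Vec ℕ n) → CoversSupport (support y) y
support-covers (zero  ∷ y) fzero    0≢0  = ⊥-elim (0≢0 refl)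
support-covers (suc _ ∷ y) fzero    _    = fzero , refl
support-covers (zero  ∷ y) (fsuc i) yᵢ≢0 = Product.map₂ (cong fsuc) (support-covers y i yᵢ≢0)
support-covers (suc _ ∷ y) (fsuc i) yᵢ≢0 = Product.map fsuc (cong fsuc) (support-covers y i yᵢ≢0)

covering⇒supp≤ : ∀ {k n} {ι : Fin k → Fin n} (y : Vec ℕ n) → CoversSupport ι y → supp y ≤ k
covering⇒supp≤ {ι = ι} y covers = Finₚ.injective⇒≤ preimage-injective
  where
  preimage : Fin (supp y) → _
  preimage s = proj₁ (covers (support y s) (support-nonzero y s))
  preimage-injective : Injective _≡_ _≡_ preimage
  preimage-injective {s} {s′} e = support-injective y (begin
    support y s       ≡⟨ proj₂ (covers (support y s) (support-nonzero y s)) ⟨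
    ι (preimage s)     ≡⟨ cong ι e ⟩
    ι (preimage s′)    ≡⟨ proj₂ (covers (support y s′) (support-nonzero y s′)) ⟩
    support y s′      ∎)
    where open ≡-Reasoning

supp≤⇒covering : ∀ {m n} (y : Vec ℕ n) → supp y ≤ m → m ≤ n →
  ∃[ ι ] (Injective _≡_ _≡_ ι × CoversSupport {m} ι y)
supp≤⇒covering y s≤m m≤n with m≤n⇒m<n∨m≡n m≤n
... | inj₂ refl = id , id , λ i _ → i , refl
supp≤⇒covering (zero ∷ y) s≤m _ | inj₁ (s≤s m≤n) with supp≤⇒covering y s≤m m≤n
... | ι , ι-inj , covers = fsuc ∘ ι , ι-inj ∘ Finₚ.suc-injective , covers′
  where
  covers′ : CoversSupport (fsuc ∘ ι) (zero ∷ y)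
  covers′ fzero    0≢0  = ⊥-elim (0≢0 refl)
  covers′ (fsuc i) yᵢ≢0 = Product.map₂ (cong fsuc) (covers i yᵢ≢0)
supp≤⇒covering (suc _ ∷ y) (s≤s s≤m) _ | inj₁ (s≤s m≤n) with supp≤⇒covering y s≤m (≤-trans (n≤1+n _) m≤n)
... | ι , ι-inj , covers = Fin.lift 1 ι , Finₚ.lift-injective ι ι-inj 1 , covers′
  where
  covers′ : CoversSupport (Fin.lift 1 ι) (suc _ ∷ y)
  covers′ fzero    _    = fzero , refl
  covers′ (fsuc i) yᵢ≢0 = Product.map fsuc (cong fsuc) (covers i yᵢ≢0)

supp-act : ∀ {m n} (π : Fin m → Fin n) v → supp (act π v) ≤ m
supp-act π v = covering⇒supp≤ (act π v) covers
  where
  covers : CoversSupport π (act π v)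
  covers i nonzero with Finₚ.any? (λ k → π k Fin.≟ i)
  ... | yes hit = hit
  ... | no miss = ⊥-elim (nonzero (trans (sym (at-toℕ (act π v) i))
                   (at-act-outside π v (toℕ i) (λ k e → miss (k , Finₚ.toℕ-injective e)))))

act-restriction : ∀ {m n} {ι : Fin m → Fin n} → Injective _≡_ _≡_ ι → ∀ {g} → CoversSupport ι g →
  g ≡ act ι (tabulate (lookup g ∘ ι))
act-restriction {ι = ι} ι-inj {g} covers = lookup-injective agree
  where
  u = tabulate (lookup g ∘ ι)
  agree : ∀ i → lookup g i ≡ lookup (act ι u) i
  agree i with Finₚ.any? (λ t → ι t Fin.≟ i)
  ... | yes (t , refl) = begin
    lookup g (ι t)             ≡⟨ Vecₚ.lookup∘tabulate (lookup g ∘ ι) t ⟨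
    lookup u t                 ≡⟨ at-act-image ι-inj u t ⟨
    at (act ι u) (toℕ (ι t))   ≡⟨ at-toℕ (act ι u) (ι t) ⟩
    lookup (act ι u) (ι t)     ∎
    where open ≡-Reasoning
  ... | no i∉ι with lookup g i ≟ 0
  ...   | no  gᵢ≢0 = ⊥-elim (i∉ι (covers i gᵢ≢0))
  ...   | yes gᵢ≡0 = trans gᵢ≡0 (sym (trans (sym (at-toℕ (act ι u) i))
                       (at-act-outside ι u (toℕ i) (λ t e → i∉ι (t , Finₚ.toℕ-injective e)))))

-- Permutations of Fin n

⟨$⟩ʳ-injective : ∀ {n} (ρ : Permutation′ n) → Injective _≡_ _≡_ (ρ ⟨$⟩ʳ_)
⟨$⟩ʳ-injective ρ {i} {j} e = trans (sym (inverseˡ ρ)) (trans (cong (ρ ⟨$⟩ˡ_) e) (inverseˡ ρ))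

transpose-sends : ∀ {n} (i j : Fin n) → transpose i j ⟨$⟩ʳ i ≡ j
transpose-sends i j rewrite dec-true (i Fin.≟ i) refl = refl

transpose-fixes : ∀ {n} {i j k : Fin n} → k ≢ i → k ≢ j → transpose i j ⟨$⟩ʳ k ≡ k
transpose-fixes {i = i} {j} {k} k≢i k≢j
  rewrite dec-false (k Fin.≟ i) k≢i | dec-false (k Fin.≟ j) k≢j = refl

-- Induction on s, correcting the image of α 0 by a transposition that fixes
-- all the values already placed.
permutation-extending : ∀ {s n} {α β : Fin s → Fin n} → Injective _≡_ _≡_ α → Injective _≡_ _≡_ β →
  ∃[ ρ ] (∀ t → ρ ⟨$⟩ʳ α t ≡ β t)
permutation-extending {zero} _ _ = Perm.id , λ ()
permutation-extending {suc s} {α = α} {β} α-inj β-inj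
  with permutation-extending {α = α ∘ fsuc} {β ∘ fsuc}
         (Finₚ.suc-injective ∘ α-inj) (Finₚ.suc-injective ∘ β-inj)
... | ρ , ρα≡β = ρ ∘ₚ τ , sends
  where
  τ = transpose (ρ ⟨$⟩ʳ α fzero) (β fzero)
  sends : ∀ t → τ ⟨$⟩ʳ (ρ ⟨$⟩ʳ α t) ≡ β t
  sends fzero    = transpose-sends (ρ ⟨$⟩ʳ α fzero) (β fzero)
  sends (fsuc t) = trans (cong (τ ⟨$⟩ʳ_) (ρα≡β t)) (transpose-fixes
    (λ e → suc≢zero (α-inj (⟨$⟩ʳ-injective ρ (trans (ρα≡β t) e))))
    (suc≢zero ∘ β-inj))
    where
    suc≢zero : fsuc t ≢ fzero
    suc≢zero ()

extendℕ : ∀ {m n} → (Fin m → Fin n) → ℕ → ℕ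
extendℕ {m} f k with k <? m
... | yes k<m = toℕ (f (fromℕ< k<m))
... | no _    = k

extendℕ-toℕ : ∀ {m n} (f : Fin m → Fin n) i → extendℕ f (toℕ i) ≡ toℕ (f i)
extendℕ-toℕ {m} f i with toℕ i <? m
... | yes i<m = cong (toℕ ∘ f) (Finₚ.fromℕ<-toℕ i i<m)
... | no i≮m  = ⊥-elim (i≮m (Finₚ.toℕ<n i))

extendℕ-≥ : ∀ {m n} (f : Fin m → Fin n) {k} → m ≤ k → extendℕ f k ≡ k
extendℕ-≥ {m} f {k} m≤k with k <? m
... | yes k<m = ⊥-elim (<⇒≱ k<m m≤k)
... | no _    = refl

extendℕ-inverse : ∀ {n} {f g : Fin n → Fin n} → (∀ i → g (f i) ≡ i) → ∀ k → extendℕ g (extendℕ f k) ≡ k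
extendℕ-inverse {n} {f} {g} gf≡id k = by-cases (k <? n)
  where
  by-cases : Dec (k < n) → extendℕ g (extendℕ f k) ≡ k
  by-cases (no k≮n)  = trans (cong (extendℕ g) (extendℕ-≥ f (≮⇒≥ k≮n))) (extendℕ-≥ g (≮⇒≥ k≮n))
  by-cases (yes k<n) = begin
    extendℕ g (extendℕ f k)         ≡⟨ cong (extendℕ g ∘ extendℕ f) (Finₚ.toℕ-fromℕ< k<n) ⟨
    extendℕ g (extendℕ f (toℕ i))   ≡⟨ cong (extendℕ g) (extendℕ-toℕ f i) ⟩
    extendℕ g (toℕ (f i))           ≡⟨ extendℕ-toℕ g (f i) ⟩
    toℕ (g (f i))                   ≡⟨ cong toℕ (gf≡id i) ⟩
    toℕ i                           ≡⟨ Finₚ.toℕ-fromℕ< k<n ⟩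
    k                               ∎
    where
    open ≡-Reasoning
    i = fromℕ< k<n

extendℕ-IsFinPerm : ∀ {n} (ρ : Permutation′ n) → IsFinPerm (extendℕ (ρ ⟨$⟩ʳ_))
extendℕ-IsFinPerm {n} ρ = (injective , surjective) , n , λ k → extendℕ-≥ (ρ ⟨$⟩ʳ_)
  where
  ρ⁻¹ℕ = extendℕ (ρ ⟨$⟩ˡ_)
  injective : Injective _≡_ _≡_ (extendℕ (ρ ⟨$⟩ʳ_))
  injective {a} {b} e = trans (sym (extendℕ-inverse (λ _ → inverseˡ ρ) a))
                              (trans (cong ρ⁻¹ℕ e) (extendℕ-inverse (λ _ → inverseˡ ρ) b))
  surjective : Surjective _≡_ _≡_ (extendℕ (ρ ⟨$⟩ʳ_))
  surjective y = ρ⁻¹ℕ y , λ { refl → extendℕ-inverse (λ _ → inverseʳ ρ) y }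

-- Rearrangements of finitely supported sequences

record Rearrangement (f h : ℕ → ℕ) : Set where
  field
    σ         : ℕ → ℕ
    injective : ∀ {i j} → f i ≢ 0 → f j ≢ 0 → σ i ≡ σ j → i ≡ j
    moves     : ∀ {i} → f i ≢ 0 → h (σ i) ≡ f i
    onto      : ∀ {j} → h j ≢ 0 → ∃[ i ] (f i ≢ 0 × σ i ≡ j)

Rearrangement-respʳ : ∀ {f h h′} → h ≗ h′ → Rearrangement f h → Rearrangement f h′
Rearrangement-respʳ h≗h′ r = record
  { σ = σ ; injective = injective ; moves = λ fᵢ≢0 → trans (sym (h≗h′ _)) (moves fᵢ≢0)
  ; onto = λ h′ⱼ≢0 → onto (h′ⱼ≢0 ∘ trans (sym (h≗h′ _))) }
  where open Rearrangement r

Rearrangement-sym : ∀ {f h} → Rearrangement f h → Rearrangement h f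
Rearrangement-sym {f} {h} r = record
  { σ = τ
  ; injective = λ hᵢ≢0 hⱼ≢0 τi≡τj → trans (sym (σ∘τ hᵢ≢0)) (trans (cong σ τi≡τj) (σ∘τ hⱼ≢0))
  ; moves = λ hⱼ≢0 → trans (sym (moves (fτ≢0 hⱼ≢0))) (cong h (σ∘τ hⱼ≢0))
  ; onto = λ {i} fᵢ≢0 → σ i , hσ≢0 fᵢ≢0 , injective (fτ≢0 (hσ≢0 fᵢ≢0)) fᵢ≢0 (σ∘τ (hσ≢0 fᵢ≢0))
  }
  where
  open Rearrangement r
  preimage : ∀ {j} → Dec (h j ≡ 0) → ℕ
  preimage (yes _)   = 0    -- arbitrary: τ only matters on the support of h
  preimage (no hⱼ≢0) = proj₁ (onto hⱼ≢0)
  τ : ℕ → ℕ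
  τ j = preimage (h j ≟ 0)
  τ-spec : ∀ {j} → h j ≢ 0 → f (τ j) ≢ 0 × σ (τ j) ≡ j
  τ-spec {j} hⱼ≢0 with h j ≟ 0
  ... | yes hⱼ≡0 = ⊥-elim (hⱼ≢0 hⱼ≡0)
  ... | no  hⱼ≢0 = proj₂ (onto hⱼ≢0)
  fτ≢0 : ∀ {j} → h j ≢ 0 → f (τ j) ≢ 0
  fτ≢0 = proj₁ ∘ τ-spec
  σ∘τ : ∀ {j} → h j ≢ 0 → σ (τ j) ≡ j
  σ∘τ = proj₂ ∘ τ-spec
  hσ≢0 : ∀ {i} → f i ≢ 0 → h (σ i) ≢ 0
  hσ≢0 fᵢ≢0 = fᵢ≢0 ∘ trans (sym (moves fᵢ≢0))

act-Rearrangement : ∀ {m n} {π : Fin m → Fin n} → Injective _≡_ _≡_ π → ∀ v →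
  Rearrangement (at v) (at (act π v))
act-Rearrangement {π = π} π-inj v =
  record { σ = extendℕ π ; injective = injective ; moves = moves ; onto = onto }
  where
  injective : ∀ {i j} → at v i ≢ 0 → at v j ≢ 0 → extendℕ π i ≡ extendℕ π j → i ≡ j
  injective vᵢ≢0 vⱼ≢0 e with at-nonzero⇒index v vᵢ≢0 | at-nonzero⇒index v vⱼ≢0
  ... | a , refl | b , refl = cong toℕ (π-inj (Finₚ.toℕ-injective
          (trans (sym (extendℕ-toℕ π a)) (trans e (extendℕ-toℕ π b)))))
  moves : ∀ {i} → at v i ≢ 0 → at (act π v) (extendℕ π i) ≡ at v i
  moves vᵢ≢0 with at-nonzero⇒index v vᵢ≢0
  ... | a , refl = begin
    at (act π v) (extendℕ π (toℕ a))  ≡⟨ cong (at (act π v)) (extendℕ-toℕ π a) ⟩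
    at (act π v) (toℕ (π a))          ≡⟨ at-act-image π-inj v a ⟩
    lookup v a                        ≡⟨ at-toℕ v a ⟨
    at v (toℕ a)                      ∎
    where open ≡-Reasoning
  onto : ∀ {j} → at (act π v) j ≢ 0 → ∃[ i ] (at v i ≢ 0 × extendℕ π i ≡ j)
  onto {j} nonzero with Finₚ.any? (λ a → toℕ (π a) ≟ j)
  ... | yes (a , refl) = toℕ a ,
        (λ vₐ≡0 → nonzero (trans (at-act-image π-inj v a) (trans (sym (at-toℕ v a)) vₐ≡0))) ,
        extendℕ-toℕ π a
  ... | no  j∉π        = ⊥-elim (nonzero (at-act-outside π v j (λ a e → j∉π (a , e))))

bijection-Rearrangement : ∀ {σ : ℕ → ℕ} {f h} → Injective _≡_ _≡_ σ → Surjective _≡_ _≡_ σ →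
  (∀ k → h (σ k) ≡ f k) → Rearrangement f h
bijection-Rearrangement {σ} {f} {h} σ-inj σ-surj hσ≡f = record
  { σ = σ ; injective = λ _ _ → σ-inj ; moves = λ {i} _ → hσ≡f i ; onto = onto }
  where
  onto : ∀ {j} → h j ≢ 0 → ∃[ i ] (f i ≢ 0 × σ i ≡ j)
  onto {j} hⱼ≢0 with σ-surj j
  ... | i , σi≡j = i , (λ fᵢ≡0 → hⱼ≢0 (trans (cong h (sym (σi≡j refl))) (trans (hσ≡f i) fᵢ≡0))) , σi≡j refl

module _ {n} {f h : ℕ → ℕ} (f≥n : VanishesFrom n f) (h≥n : VanishesFrom n h) (r : Rearrangement f h) where
  open Rearrangement r

  private
    α : Fin (supp (toVec n f)) → Fin n
    α = support (toVec n f)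

    f∘α≢0 : ∀ s → f (toℕ (α s)) ≢ 0
    f∘α≢0 s = support-nonzero (toVec n f) s ∘ trans (Vecₚ.lookup∘tabulate (f ∘ toℕ) (α s))

    α-onto : ∀ {i} → f i ≢ 0 → ∃[ s ] toℕ (α s) ≡ i
    α-onto {i} fᵢ≢0 with at-nonzero⇒index (toVec n f) (fᵢ≢0 ∘ trans (sym (at-toVec n f≥n i)))
    ... | a , refl with support-covers (toVec n f) a (fᵢ≢0 ∘ trans (sym (Vecₚ.lookup∘tabulate (f ∘ toℕ) a)))
    ...   | s , refl = s , refl

    σ<n : ∀ {i} → f i ≢ 0 → σ i < n
    σ<n {i} fᵢ≢0 with σ i <? n
    ... | yes σi<n = σi<n
    ... | no  σi≮n = ⊥-elim (fᵢ≢0 (trans (sym (moves fᵢ≢0)) (h≥n (σ i) (≮⇒≥ σi≮n))))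

    β : Fin (supp (toVec n f)) → Fin n
    β s = fromℕ< (σ<n (f∘α≢0 s))

    β-toℕ : ∀ s → toℕ (β s) ≡ σ (toℕ (α s))
    β-toℕ s = Finₚ.toℕ-fromℕ< (σ<n (f∘α≢0 s))

    β-injective : Injective _≡_ _≡_ β
    β-injective {s} {s′} e = support-injective (toVec n f) (Finₚ.toℕ-injective
      (injective (f∘α≢0 s) (f∘α≢0 s′) (trans (sym (β-toℕ s)) (trans (cong toℕ e) (β-toℕ s′)))))

  Rearrangement⇒Permutation : ∃[ ρ ] (∀ i → h (toℕ (ρ ⟨$⟩ʳ i)) ≡ f (toℕ i))
  Rearrangement⇒Permutation = ρ , realises
    where
    extension = permutation-extending (support-injective (toVec n f)) β-injective
    ρ = proj₁ extension
    ρ∘α : ∀ s → toℕ (ρ ⟨$⟩ʳ α s) ≡ σ (toℕ (α s))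
    ρ∘α s = trans (cong toℕ (proj₂ extension s)) (β-toℕ s)
    realises : ∀ i → h (toℕ (ρ ⟨$⟩ʳ i)) ≡ f (toℕ i)
    realises i with f (toℕ i) ≟ 0
    ... | no fᵢ≢0 with α-onto fᵢ≢0
    ...   | s , αs≡i with Finₚ.toℕ-injective αs≡i
    ...     | refl = trans (cong h (ρ∘α s)) (moves (f∘α≢0 s))
    realises i | yes fᵢ≡0 with h (toℕ (ρ ⟨$⟩ʳ i)) ≟ 0
    ... | yes hρᵢ≡0 = trans hρᵢ≡0 (sym fᵢ≡0)
    ... | no  hρᵢ≢0 with onto hρᵢ≢0
    ...   | i′ , fᵢ′≢0 , σi′≡ρi with α-onto fᵢ′≢0
    ...     | s , refl = ⊥-elim (f∘α≢0 s (subst (λ a → f (toℕ a) ≡ 0) (sym αs≡i) fᵢ≡0))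
      where
      αs≡i : α s ≡ i
      αs≡i = ⟨$⟩ʳ-injective ρ (Finₚ.toℕ-injective (trans (ρ∘α s) σi′≡ρi))

lookup-injective-⟨$⟩ʳ : ∀ {n} (ρ : Permutation′ n) {v w : Vec ℕ n} →
  (∀ i → lookup v (ρ ⟨$⟩ʳ i) ≡ lookup w (ρ ⟨$⟩ʳ i)) → v ≡ w
lookup-injective-⟨$⟩ʳ ρ {v} {w} agree = lookup-injective λ p →
  subst (λ q → lookup v q ≡ lookup w q) (inverseʳ ρ) (agree (ρ ⟨$⟩ˡ p))

Rearrangement⇒act : ∀ {k n} {v : Vec ℕ k} {y : Vec ℕ n} → k ≤ n → Rearrangement (at v) (at y) →
  ∃[ π ] (Injective _≡_ _≡_ π × y ≡ act π v)
Rearrangement⇒act {k} {n} {v} {y} k≤n r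
  with Rearrangement⇒Permutation (at-vanishes v k≤n) (at-vanishes y ≤-refl) r
... | ρ , realises = π , π-injective , lookup-injective-⟨$⟩ʳ ρ agree
  where
  open ≡-Reasoning
  π : Fin k → Fin n
  π t = ρ ⟨$⟩ʳ inject≤ t k≤n
  π-injective : Injective _≡_ _≡_ π
  π-injective = Finₚ.inject≤-injective k≤n k≤n _ _ ∘ ⟨$⟩ʳ-injective ρ
  agree : ∀ i → lookup y (ρ ⟨$⟩ʳ i) ≡ lookup (act π v) (ρ ⟨$⟩ʳ i)
  agree i with toℕ i <? k
  ... | yes i<k = begin
    lookup y (ρ ⟨$⟩ʳ i)            ≡⟨ at-toℕ y _ ⟨
    at y (toℕ (ρ ⟨$⟩ʳ i))          ≡⟨ realises i ⟩
    at v (toℕ i)                  ≡⟨ cong (at v) (Finₚ.toℕ-fromℕ< i<k) ⟨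
    at v (toℕ t)                  ≡⟨ at-toℕ v t ⟩
    lookup v t                    ≡⟨ at-act-image π-injective v t ⟨
    at (act π v) (toℕ (π t))      ≡⟨ at-toℕ (act π v) (π t) ⟩
    lookup (act π v) (π t)        ≡⟨ cong (lookup (act π v) ∘ (ρ ⟨$⟩ʳ_)) t↦i ⟩
    lookup (act π v) (ρ ⟨$⟩ʳ i)    ∎
    where
    t = fromℕ< i<k
    t↦i : inject≤ t k≤n ≡ i
    t↦i = Finₚ.toℕ-injective (trans (Finₚ.toℕ-inject≤ t k≤n) (Finₚ.toℕ-fromℕ< i<k))
  ... | no i≮k = begin
    lookup y (ρ ⟨$⟩ʳ i)            ≡⟨ at-toℕ y _ ⟨
    at y (toℕ (ρ ⟨$⟩ʳ i))          ≡⟨ realises i ⟩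
    at v (toℕ i)                  ≡⟨ at-vanishes v ≤-refl (toℕ i) (≮⇒≥ i≮k) ⟩
    0                             ≡⟨ at-act-outside π v _ outside ⟨
    at (act π v) (toℕ (ρ ⟨$⟩ʳ i))  ≡⟨ at-toℕ (act π v) _ ⟩
    lookup (act π v) (ρ ⟨$⟩ʳ i)    ∎
    where
    outside : ∀ t → toℕ (π t) ≢ toℕ (ρ ⟨$⟩ʳ i)
    outside t e = i≮k (subst (_< k) (trans (sym (Finₚ.toℕ-inject≤ t k≤n)) (cong toℕ t↦i)) (Finₚ.toℕ<n t))
      where
      t↦i : inject≤ t k≤n ≡ i
      t↦i = ⟨$⟩ʳ-injective ρ (Finₚ.toℕ-injective e)

Rearrangement⇒FinPerm : ∀ {n f h} → VanishesFrom n f → VanishesFrom n h → Rearrangement f h →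
  ∃₂ λ (σ τ : ℕ → ℕ) → IsFinPerm σ × (∀ j → σ (τ j) ≡ j) × (∀ k → τ (σ k) ≡ k) × (∀ k → h (σ k) ≡ f k)
Rearrangement⇒FinPerm {n} {f} {h} f≥n h≥n r with Rearrangement⇒Permutation f≥n h≥n r
... | ρ , realises =
  σ , extendℕ (ρ ⟨$⟩ˡ_) , extendℕ-IsFinPerm ρ ,
  extendℕ-inverse {f = ρ ⟨$⟩ˡ_} {ρ ⟨$⟩ʳ_} (λ _ → inverseʳ ρ) ,
  extendℕ-inverse {f = ρ ⟨$⟩ʳ_} {ρ ⟨$⟩ˡ_} (λ _ → inverseˡ ρ) , λ k → by-cases k (k <? n)
  where
  σ = extendℕ (ρ ⟨$⟩ʳ_)
  by-cases : ∀ k → Dec (k < n) → h (σ k) ≡ f k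
  by-cases k (no k≮n)  = trans (cong h (extendℕ-≥ (ρ ⟨$⟩ʳ_) (≮⇒≥ k≮n)))
                               (trans (h≥n k (≮⇒≥ k≮n)) (sym (f≥n k (≮⇒≥ k≮n))))
  by-cases k (yes k<n) = begin
    h (σ k)                 ≡⟨ cong (h ∘ σ) (Finₚ.toℕ-fromℕ< k<n) ⟨
    h (σ (toℕ i))           ≡⟨ cong h (extendℕ-toℕ (ρ ⟨$⟩ʳ_) i) ⟩
    h (toℕ (ρ ⟨$⟩ʳ i))       ≡⟨ realises i ⟩
    f (toℕ i)               ≡⟨ cong f (Finₚ.toℕ-fromℕ< k<n) ⟩
    f k                     ∎
    where
    open ≡-Reasoning
    i = fromℕ< k<n

SymInf-image⇒act : ∀ {k n} {σ : ℕ → ℕ} {h} (v : Vec ℕ k) → k ≤ n → Bijective _≡_ _≡_ σ →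
  (∀ i → h (σ i) ≡ at v i) → VanishesFrom n h → ∃[ π ] (Injective _≡_ _≡_ π × toVec n h ≡ act π v)
SymInf-image⇒act {n = n} v k≤n (σ-inj , σ-surj) hσ≡v h≥n =
  Rearrangement⇒act {v = v} k≤n
    (Rearrangement-respʳ (sym ∘ at-toVec n h≥n) (bijection-Rearrangement σ-inj σ-surj hσ≡v))

-- Every generator is moved by the same finite permutation of ℕ, the one realising ι.
Comb-act-SymInf : ∀ {m n} {G : List (Vec ℕ m)} {ι : Fin m → Fin n} → m ≤ n → Injective _≡_ _≡_ ι →
  ∀ {u} → Comb at (_∈ G) (at u) → Comb id (SymInfImg (map at G)) (at (act ι u))
Comb-act-SymInf {G = G} {ι = ι} m≤n ι-inj {u} (L , gs , u≗L)
  with Rearrangement⇒FinPerm (at-vanishes u m≤n) (at-vanishes (act ι u) ≤-refl) (act-Rearrangement ι-inj u)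
... | σ , τ , σ-perm , στ≡id , τσ≡id , realises =
  Comb-bind (λ g∈G _ → Comb-singleton (moved g∈G))
            (Comb-resp (λ j → trans (sym (realises (τ j))) (cong (at (act ι u)) (στ≡id j)))
                       (L , gs , u≗L ∘ τ))
  where
  moved : ∀ {g} → g ∈ G → SymInfImg (map at G) (at g ∘ τ)
  moved {g} g∈G = σ , σ-perm , Anyₚ.map⁺ (Any.map (λ { refl k → cong (at g) (τσ≡id k) }) g∈G)

SymInf-vanishes : ∀ {r} {G : List (Vec ℕ r)} {h} → SymInfImg (map at G) h → ∃[ N ] VanishesFrom N h
SymInf-vanishes {r} {h = h} (σ , (_ , B , σ-fixes) , any) with find (Anyₚ.map⁻ any)
... | g , _ , hσ≡g = B ⊔ r , λ j N≤j → begin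
  h j        ≡⟨ cong h (σ-fixes j (≤-trans (m≤m⊔n B r) N≤j)) ⟨
  h (σ j)    ≡⟨ hσ≡g j ⟩
  at g j     ≡⟨ at-vanishes g ≤-refl j (≤-trans (m≤n⊔m B r) N≤j) ⟩
  0          ∎
  where open ≡-Reasoning

-- Finite orbits

allVecs : ∀ {A : Set} m → List A → List (Vec A m)
allVecs zero    xs = [] ∷ []
allVecs (suc m) xs = List.cartesianProductWith _∷_ xs (allVecs m xs)

∈-allVecs : ∀ {A : Set} {xs : List A} → (∀ x → x ∈ xs) → ∀ {m} (v : Vec A m) → v ∈ allVecs m xs
∈-allVecs enum []      = here refl
∈-allVecs enum (x ∷ v) = ∈-cartesianProductWith⁺ _∷_ (enum x) (∈-allVecs enum v)

injective? : ∀ {m n} (f : Fin m → Fin n) → Dec (Injective _≡_ _≡_ f)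
injective? f = map′ (λ inj {a} {b} → inj a b) (λ inj a b → inj)
  (Finₚ.all? λ a → Finₚ.all? λ b → (f a Fin.≟ f b) →-dec (a Fin.≟ b))

injections : ∀ m n → List (Vec (Fin n) m)
injections m n = List.filter (injective? ∘ lookup) (allVecs m (allFin n))

orbit : ∀ m n → List (Vec ℕ m) → List (Vec ℕ n)
orbit m n G = List.cartesianProductWith (λ p g → act (lookup p) g) (injections m n) G

∈-orbit⁺ : ∀ {m n} {G : List (Vec ℕ m)} → SymImg m n (_∈ G) ⊆ (_∈ orbit m n G)
∈-orbit⁺ {m} {n} {G} (π , π-inj , g , g∈G , refl) =
  subst (_∈ orbit m n G) (act-cong (Vecₚ.lookup∘tabulate π) g)
    (∈-cartesianProductWith⁺ (λ p g → act (lookup p) g)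
      (∈-filter⁺ (injective? ∘ lookup) (∈-allVecs ∈-allFin (tabulate π)) lookup-inj) g∈G)
  where
  lookup-inj : Injective _≡_ _≡_ (lookup (tabulate π))
  lookup-inj {a} {b} e = π-inj (trans (sym (Vecₚ.lookup∘tabulate π a)) (trans e (Vecₚ.lookup∘tabulate π b)))

∈-orbit⁻ : ∀ {m n} {G : List (Vec ℕ m)} → (_∈ orbit m n G) ⊆ SymImg m n (_∈ G)
∈-orbit⁻ {m} {n} {G} x∈orbit
  with ∈-cartesianProductWith⁻ (λ p g → act (lookup p) g) (injections m n) G x∈orbit
... | p , g , p∈inj , g∈G , refl =
  lookup p , proj₂ (∈-filter⁻ (injective? ∘ lookup) {xs = allVecs m (allFin n)} p∈inj) , g , g∈G , refl

All-orbit : ∀ {m n} {G : List (Vec ℕ m)} {P : Pred (Vec ℕ n) 0ℓ} → SymImg m n (_∈ G) ⊆ P → All P (orbit m n G)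
All-orbit P-orbit = All.tabulate (P-orbit ∘ ∈-orbit⁻)

supp-orbit : ∀ {m n} {G : List (Vec ℕ m)} → All (λ x → supp x ≤ m) (orbit m n G)
supp-orbit = All-orbit λ { (π , _ , g , _ , refl) → supp-act π g }

SymImg-mono : ∀ {m n} {A B : Pred (Vec ℕ m) 0ℓ} → A ⊆ B → SymImg m n A ⊆ SymImg m n B
SymImg-mono A⊆B (π , π-inj , v , a , e) = π , π-inj , v , A⊆B a , e

Comb-orbit : ∀ {m n} {G : List (Vec ℕ m)} → SymImg m n (Mon (_∈ G)) ⊆ (Comb at (_∈ orbit m n G) ∘ at)
Comb-orbit {m} {n} (π , π-inj , u , u∈MonG , refl) with Mon⇒Comb u∈MonG
... | L , gs , u≗L =
  Comb-bind (λ g∈G _ → Comb-singleton (∈-orbit⁺ (π , π-inj , _ , g∈G , refl)))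
            (L , gs , at-act-lincomb π-inj {u} L u≗L)

-- Sym-invariant chains of monoids

module ChainOfMonoids (M : Chain) (chain : IsChainOfMonoids M) (sym-inv : SymInvariant M) where

  Mon⊆M : ∀ {n} → 1 ≤ n → Mon (M n) ⊆ M n
  Mon⊆M 1≤n = proj₁ (proj₁ chain _ 1≤n)

  Comb⊆M : ∀ {n} → 1 ≤ n → ∀ {w : Vec ℕ n} → Comb at (M n) (at w) → M n w
  Comb⊆M 1≤n = Mon⊆M 1≤n ∘ Comb⇒Mon

  M-Limit : ∀ {n} → 1 ≤ n → ∀ {v : Vec ℕ n} → M n v → Limit M (at v)
  M-Limit {n} 1≤n {v} mv = n , 1≤n , v , mv , λ _ → refl

  M-≈ : ∀ {k n} → 1 ≤ k → k ≤ n → ∀ {v : Vec ℕ k} {w : Vec ℕ n} → M k v → v ≈ w → M n w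
  M-≈ {k} {n} 1≤k k≤n {v} mv v≈w with m≤n⇒m<n∨m≡n k≤n
  ... | inj₂ refl = subst (M n) (at-injective v≈w) mv
  M-≈ {k} {suc n} 1≤k _ {v} mv v≈w | inj₁ (s≤s k≤n) =
    proj₂ chain n (≤-trans 1≤k k≤n) (toVec n (at v)) _
      (M-≈ 1≤k k≤n mv (sym ∘ at-toVec n (at-vanishes v k≤n)))
      (λ j → trans (at-toVec n (at-vanishes v k≤n) j) (v≈w j))

  SymImg⊆M : ∀ {m n} → 1 ≤ m → m ≤ n → SymImg m n (M m) ⊆ M n
  SymImg⊆M 1≤m m≤n x = sym-inv _ _ 1≤m m≤n (Comb⇒Mon (Comb-singleton x))

  M-rearrange : ∀ {n} → 1 ≤ n → ∀ {g y : Vec ℕ n} → M n g → Rearrangement (at g) (at y) → M n y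
  M-rearrange 1≤n {g} {y} mg r with Rearrangement⇒act {v = g} {y} ≤-refl r
  ... | π , π-inj , y≡πg = SymImg⊆M 1≤n ≤-refl (π , π-inj , g , mg , y≡πg)

  SymImg-descends : ∀ {n k} → 1 ≤ n → ∀ {x} → SymImg n k (M n) x → VanishesFrom n (at x) →
    M n (toVec n (at x))
  SymImg-descends {n} 1≤n (π , π-inj , u , mu , refl) x≥n =
    M-rearrange 1≤n mu (Rearrangement-respʳ (sym ∘ at-toVec n x≥n) (act-Rearrangement π-inj u))

  M-compress : ∀ {m n} → 1 ≤ m → m ≤ n → ∀ {g} → M n g → supp g ≤ m → SymImg m n (Limit M ∘ at) g
  M-compress {m} {n} 1≤m m≤n {g} mg s≤m with supp≤⇒covering g s≤m m≤n
  ... | ι , ι-inj , covers = ι , ι-inj , u , limit , g≡ιu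
    where
    u = tabulate (lookup g ∘ ι)
    g≡ιu = act-restriction ι-inj covers
    limit : Limit M (at u)
    limit = n , ≤-trans 1≤m m≤n , toVec n (at u) ,
      M-rearrange (≤-trans 1≤m m≤n) mg (Rearrangement-respʳ (sym ∘ at-toVec n (at-vanishes u m≤n))
        (Rearrangement-sym (subst (Rearrangement (at u) ∘ at) (sym g≡ιu) (act-Rearrangement ι-inj u)))) ,
      at-toVec n (at-vanishes u m≤n)

  SymInf⊆M : ∀ {r n} {G : List (Vec ℕ r)} → 1 ≤ r → All (M r) G → r ≤ n →
    ∀ {h} → SymInfImg (map at G) h → VanishesFrom n h → M n (toVec n h)
  SymInf⊆M 1≤r G⊆M r≤n (σ , (σ-bij , _) , any) h≥n with find (Anyₚ.map⁻ any)
  ... | g , g∈G , hσ≡g with SymInf-image⇒act g r≤n σ-bij hσ≡g h≥n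
  ...   | π , π-inj , h≡πg = SymImg⊆M 1≤r r≤n (π , π-inj , g , All.lookup G⊆M g∈G , h≡πg)

  MonSeq-SymInf⊆Limit : ∀ {r} {G : List (Vec ℕ r)} → 1 ≤ r → All (M r) G →
    MonSeq (SymInfImg (map at G)) ⊆ Limit M
  MonSeq-SymInf⊆Limit {r} {G} 1≤r G⊆M {f} f∈ with Comb-vanishes SymInf-vanishes f∈
  ... | N , f≥N = n , 1≤n , toVec n f ,
        Comb⊆M 1≤n (Comb-resp (sym ∘ at-toVec n f≥n) (Comb-bind summand f∈)) , at-toVec n f≥n
    where
    n = N ⊔ r
    1≤n = ≤-trans 1≤r (m≤n⊔m N r)
    f≥n : VanishesFrom n f
    f≥n j n≤j = f≥N j (≤-trans (m≤m⊔n N r) n≤j)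
    summand : ∀ {h} → SymInfImg (map at G) h → (∀ j → h j ≤ f j) → Comb at (M n) h
    summand {h} h∈ h≤f =
      Comb-resp (at-toVec n h≥n) (Comb-singleton {x = toVec n h} (SymInf⊆M 1≤r G⊆M (m≤n⊔m N r) h∈ h≥n))
      where
      h≥n = ≤-vanishes h≤f f≥n

  ClauseB : ℕ → ℕ → Set
  ClauseB r n = ((λ (v : Vec ℕ n) → Limit M (at v)) ≐ M n)
              × ∃[ G ] (All (M n) G × All (λ g → supp g ≤ r) G × Mon (_∈ G) ≐ M n)

  ConditionA ConditionB ConditionC : Set
  ConditionA = Stabilizes M × ∃[ N ] (∀ n → N ≤ n → FinGen (M n))
  ConditionB = ∃[ r ] (∀ n → 1 ≤ n → r ≤ n → ClauseB r n)
  ConditionC = ∃[ G ] (All (Limit M) G × MonSeq (SymInfImg G) ≐ Limit M)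

  clauseB : ∀ {r n} → 1 ≤ n → (G : List (Vec ℕ n)) → All (M n) G → All (λ g → supp g ≤ r) G →
    (∀ {w : Vec ℕ n} → Limit M (at w) → Comb at (_∈ G) (at w)) → ClauseB r n
  clauseB 1≤n G G⊆M G-supp generates =
    ((λ {w} l → MonG⊆M (Comb⇒Mon (generates {w} l))) , M-Limit 1≤n) ,
    G , G⊆M , G-supp , MonG⊆M , λ {w} mw → Comb⇒Mon (generates {w} (M-Limit 1≤n mw))
    where
    MonG⊆M : Mon (_∈ G) ⊆ M _
    MonG⊆M x = Mon⊆M 1≤n (Mon-mono (All.lookup G⊆M) x)

  A⇒B : ConditionA → ConditionB
  A⇒B ((s , stable) , N , fingen) with fingen (s ⊔ N ⊔ 1) (≤-trans (m≤n⊔m s N) (m≤m⊔n _ 1))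
  ... | Gr , Gr⊆M , Gr-generates = r , λ n 1≤n r≤n →
    clauseB 1≤n (orbit r n Gr) (All-orbit (SymImg⊆M 1≤r r≤n ∘ SymImg-mono (All.lookup Gr⊆M))) supp-orbit
      (λ {w} → generates 1≤n r≤n {w})
    where
    r = s ⊔ N ⊔ 1
    s≤r : s ≤ r
    s≤r = ≤-trans (m≤m⊔n s N) (m≤m⊔n _ 1)
    1≤r : 1 ≤ r
    1≤r = m≤n⊔m _ 1

    limit⊆M : ∀ {n} → 1 ≤ n → r ≤ n → ∀ {w : Vec ℕ n} → Limit M (at w) → M n w
    limit⊆M {n} 1≤n r≤n {w} (k , 1≤k , v , mv , v≈w) with k ≤? n
    ... | yes k≤n = M-≈ 1≤k k≤n mv v≈w
    ... | no  k≰n = Comb⊆M 1≤n {w} (Comb-resp v≈w (Comb-bind descend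
                      (Mon⇒Comb (proj₂ (stable n k 1≤n (≤-trans s≤r r≤n) (<⇒≤ (≰⇒> k≰n))) mv))))
      where
      descend : ∀ {x} → SymImg n k (M n) x → (∀ j → at x j ≤ at v j) → Comb at (M n) (at x)
      descend {x} x∈ x≤v =
        Comb-resp (at-toVec n x≥n) (Comb-singleton {x = toVec n (at x)} (SymImg-descends 1≤n x∈ x≥n))
        where
        x≥n = ≤-vanishes x≤v (λ j n≤j → trans (v≈w j) (at-vanishes w ≤-refl j n≤j))

    generates : ∀ {n} → 1 ≤ n → r ≤ n → ∀ {w : Vec ℕ n} → Limit M (at w) → Comb at (_∈ orbit r n Gr) (at w)
    generates {n} 1≤n r≤n {w} l =
      Comb-bind (λ {x} x∈ _ → Comb-orbit {x = x} (SymImg-mono (proj₂ Gr-generates) x∈))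
        (Mon⇒Comb (proj₂ (stable r n 1≤r s≤r r≤n) (limit⊆M 1≤n r≤n {w} l)))

  B⇒A : ConditionB → ConditionA
  B⇒A (r , clause) = (r ⊔ 1 , stable) , r ⊔ 1 , fingen
    where
    r≤ : ∀ {n} → r ⊔ 1 ≤ n → r ≤ n
    r≤ = ≤-trans (m≤m⊔n r 1)
    1≤ : ∀ {n} → r ⊔ 1 ≤ n → 1 ≤ n
    1≤ = ≤-trans (m≤n⊔m r 1)

    fingen : ∀ n → r ⊔ 1 ≤ n → FinGen (M n)
    fingen n r′≤n with proj₂ (clause n (1≤ r′≤n) (r≤ r′≤n))
    ... | G , G⊆M , _ , G-generates = G , G⊆M , G-generates

    stable : ∀ m n → 1 ≤ m → r ⊔ 1 ≤ m → m ≤ n → Mon (SymImg m n (M m)) ≐ M n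
    stable m n 1≤m r′≤m m≤n with proj₂ (clause n (≤-trans 1≤m m≤n) (≤-trans (r≤ r′≤m) m≤n))
    ... | G , G⊆M , G-supp , G-generates =
      sym-inv m n 1≤m m≤n , λ mx → Mon-mono generator (proj₂ G-generates mx)
      where
      generator : (_∈ G) ⊆ SymImg m n (M m)
      generator g∈G = SymImg-mono (proj₁ (proj₁ (clause m 1≤m (r≤ r′≤m))))
        (M-compress 1≤m m≤n (All.lookup G⊆M g∈G) (≤-trans (All.lookup G-supp g∈G) (r≤ r′≤m)))

  B⇒C : ConditionB → ConditionC
  B⇒C (r , clause) with proj₂ (clause (r ⊔ 1) (m≤n⊔m r 1) (m≤m⊔n r 1))
  ... | Gr , Gr⊆M , _ , Gr-generates =
    G , Allₚ.map⁺ (All.map (M-Limit 1≤r′) Gr⊆M) , MonSeq-SymInf⊆Limit 1≤r′ Gr⊆M , sup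
    where
    r′ = r ⊔ 1
    1≤r′ : 1 ≤ r′
    1≤r′ = m≤n⊔m r 1
    r≤r′ : r ≤ r′
    r≤r′ = m≤m⊔n r 1
    G = map at Gr

    sup : Limit M ⊆ MonSeq (SymInfImg G)
    sup {f} (k , 1≤k , v , mv , v≗f)
      with proj₂ (clause (k ⊔ r′) (≤-trans 1≤k (m≤m⊔n k r′)) (≤-trans r≤r′ (m≤n⊔m k r′)))
    ... | Gn , Gn⊆M , Gn-supp , Gn-generates =
      Comb-resp (λ j → trans (at-toVec n v≥n j) (v≗f j))
        (Comb-bind generator (Mon⇒Comb {w = w} (proj₂ Gn-generates (M-≈ 1≤k k≤n mv (sym ∘ at-toVec n v≥n)))))
      where
      n = k ⊔ r′
      k≤n = m≤m⊔n k r′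
      r′≤n = m≤n⊔m k r′
      1≤n = ≤-trans 1≤k k≤n
      v≥n = at-vanishes v k≤n
      w = toVec n (at v)
      from-compressed : ∀ {x} → SymImg r′ n (Limit M ∘ at) x → Comb id (SymInfImg G) (at x)
      from-compressed (ι , ι-inj , u , u∈Limit , refl) =
        Comb-act-SymInf {G = Gr} {ι = ι} r′≤n ι-inj {u}
          (Mon⇒Comb {w = u} (proj₂ Gr-generates (proj₁ (proj₁ (clause r′ 1≤r′ r≤r′)) u∈Limit)))
      generator : ∀ {x} → x ∈ Gn → (∀ j → at x j ≤ at w j) → Comb id (SymInfImg G) (at x)
      generator x∈Gn _ = from-compressed
        (M-compress 1≤r′ r′≤n (All.lookup Gn⊆M x∈Gn) (≤-trans (All.lookup Gn-supp x∈Gn) r≤r′))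

  bound : ∀ {G} → All (Limit M) G → ℕ
  bound []             = 1
  bound ((k , _) ∷ ls) = k ⊔ bound ls

  generators : ∀ {G} → All (Limit M) G → ∀ n → List (Vec ℕ n)
  generators []                     n = []
  generators ((k , _ , v , _) ∷ ls) n = orbit k n (v ∷ []) ++ generators ls n

  All-generators : ∀ {G} (ls : All (Limit M) G) {n R} → bound ls ≤ R → R ≤ n →
    All (λ x → M n x × supp x ≤ R) (generators ls n)
  All-generators []                             _    _   = []
  All-generators ((k , 1≤k , v , mv , _) ∷ ls) b≤R R≤n =
    Allₚ.++⁺ (All.zipWith (Product.map₂ (λ s≤k → ≤-trans s≤k k≤R)) (All-orbit in-M , supp-orbit))
             (All-generators ls (≤-trans (m≤n⊔m k _) b≤R) R≤n)
    where
    k≤R = ≤-trans (m≤m⊔n k _) b≤R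
    in-M : SymImg k _ (_∈ v ∷ []) ⊆ M _
    in-M = SymImg⊆M 1≤k (≤-trans k≤R R≤n) ∘ SymImg-mono λ { (here refl) → mv }

  generators-realise : ∀ {G} (ls : All (Limit M) G) {n} → bound ls ≤ n →
    ∀ {h} → SymInfImg G h → VanishesFrom n h → toVec n h ∈ generators ls n
  generators-realise ls {n} b≤n {h} (σ , (σ-bij , _) , any) h≥n = go ls b≤n any
    where
    go : ∀ {G} (ls : All (Limit M) G) → bound ls ≤ n → Any (λ g → ∀ k → h (σ k) ≡ g k) G →
      toVec n h ∈ generators ls n
    go ((k , _ , v , _ , v≗g) ∷ ls) b≤n (here hσ≡g)
      with SymInf-image⇒act v (≤-trans (m≤m⊔n k _) b≤n) σ-bij (λ i → trans (hσ≡g i) (sym (v≗g i))) h≥n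
    ... | π , π-inj , h≡πv = ∈-++⁺ˡ (∈-orbit⁺ (π , π-inj , v , here refl , h≡πv))
    go ((k , _ , v , _) ∷ ls) b≤n (there any) =
      ∈-++⁺ʳ (orbit k n (v ∷ [])) (go ls (≤-trans (m≤n⊔m k _) b≤n) any)

  C⇒B : ConditionC → ConditionB
  C⇒B (G , ls , _ , limit⊆) = bound ls , λ n 1≤n r≤n →
    clauseB 1≤n (generators ls n) (All.map proj₁ (All-generators ls ≤-refl r≤n))
      (All.map proj₂ (All-generators ls ≤-refl r≤n)) (λ {w} → generates r≤n {w})
    where
    generates : ∀ {n} → bound ls ≤ n → ∀ {w : Vec ℕ n} → Limit M (at w) → Comb at (_∈ generators ls n) (at w)
    generates {n} r≤n {w} l = Comb-bind summand (limit⊆ l)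
      where
      summand : ∀ {h} → SymInfImg G h → (∀ j → h j ≤ at w j) → Comb at (_∈ generators ls n) h
      summand {h} h∈ h≤w =
        Comb-resp (at-toVec n h≥n) (Comb-singleton {x = toVec n h} (generators-realise ls r≤n h∈ h≥n))
        where
        h≥n = ≤-vanishes h≤w (at-vanishes w ≤-refl)

corollary5p13 : (M : Chain) → IsChainOfMonoids M → SymInvariant M →
  let Minf = Limit M
      A = Stabilizes M × ∃[ N ] (∀ n → N ≤ n → FinGen (M n))
      B = ∃[ r ] (∀ n → 1 ≤ n → r ≤ n →
            ((λ (v : Vec ℕ n) → Minf (at v)) ≐ M n)
            × ∃[ G ] (All (M n) G × All (λ g → supp g ≤ r) G × Mon (λ v → Any (v ≡_) G) ≐ M n))
      C = ∃[ G ] (All Minf G × MonSeq (SymInfImg G) ≐ Minf)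
  in (A ⇔ B) × (B ⇔ C)
corollary5p13 M chain sym-inv = mk⇔ A⇒B B⇒A , mk⇔ B⇒C C⇒B
  where open ChainOfMonoids M chain sym-inv
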